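{- Let $q$ be an odd prime power with $q>4$. There is no linear code $C\subseteq\mathbb{F}_q^7$ of dimension $3$ such that every nonzero codeword of $C$ has Hamming weight $4$, $6$, or $7$.
   Context: The Hamming weight of a vector is its number of nonzero coordinates. -}

module Defs where

open import Level using (Level; _⊔_)
open import Data.Nat using (ℕ; suc; _^_) renaming (_+_ to _+ℕ_)
open import Data.Nat.Primality using (Prime)
open import Data.Fin using (Fin)
open import Data.List using (List; allFin; foldr)
open import Data.Product using (Σ; ∃; _×_)
open import Relation.Binary.PropositionalEquality using (_≡_)
open import Relation.Binary.Definitions using (Decidable)
open import Relation.Nullary using (¬_; does)
open import Data.Bool using (if_then_else_)
open import Algebra.Bundles using (CommutativeRing)

IsPrimePower : ℕ → Set
IsPrimePower q = ∃ λ p → ∃ λ k → Prime p × q ≡ p ^ suc k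

record IsFiniteField {c ℓ : Level} (F : CommutativeRing c ℓ) (q : ℕ) : Set (c ⊔ ℓ) where
  open CommutativeRing F
  field
    1≉0      : ¬ (1# ≈ 0#)
    inverse  : ∀ x → ¬ (x ≈ 0#) → Σ Carrier λ y → (x * y) ≈ 1#
    _≟_      : Decidable _≈_
    enum     : Fin q → Carrier
    enum-inj : ∀ i j → enum i ≈ enum j → i ≡ j
    enum-sur : ∀ x → Σ (Fin q) λ i → enum i ≈ x

module _ {c ℓ : Level} (F : CommutativeRing c ℓ) (dec : Decidable (CommutativeRing._≈_ F)) where
  open CommutativeRing F

  weight : {n : ℕ} → (Fin n → Carrier) → ℕ
  weight {n} v = foldr (λ i acc → (if does (dec (v i) 0#) then 0 else 1) +ℕ acc) 0 (allFin n)

  sumFin : {k : ℕ} → (Fin k → Carrier) → Carrier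
  sumFin {k} f = foldr (λ i acc → f i + acc) 0# (allFin k)

  encode : {k n : ℕ} → (Fin k → Fin n → Carrier) → (Fin k → Carrier) → Fin n → Carrier
  encode G u j = sumFin (λ i → u i * G i j)

  IsZeroVec : {n : ℕ} → (Fin n → Carrier) → Set ℓ
  IsZeroVec v = ∀ i → v i ≈ 0#

  -- the k rows of G are linearly independent, i.e. C = {uG} has dimension k
  RowsIndependent : {k n : ℕ} → (Fin k → Fin n → Carrier) → Set (c ⊔ ℓ)
  RowsIndependent G = ∀ u → IsZeroVec (encode G u) → IsZeroVec u

{-# OPTIONS --safe #-}

-- Read the columns of the generator matrix G as seven points of the projective plane over F:
-- a nonzero message u is a line, and uG vanishes exactly at the points on that line. Weights
-- 4, 6, 7 say that every line carries 3, 1 or 0 of the seven points. Through a point there are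
-- q + 1 ≥ 6 lines but at most five other points, so some line through it carries no further
-- point; this rules out repeated (or zero) points. Hence every line through two of the points
-- carries exactly one more, and the seven points form a Fano plane. But the diagonal points of
-- a quadrangle are collinear only in characteristic 2, while q is odd.
module Submission where

open import Defs
open import Level using (Level; _⊔_)
open import Data.Nat as ℕ using (ℕ; zero; suc; _>_; _%_; _≤_; _<_; z≤n; s≤s)
import Data.Nat.Properties as ℕ
open import Data.Nat.DivMod using (m*n%n≡0)
open import Data.Fin as Fin using (Fin; zero; suc; punchOut; _<?_)
import Data.Fin.Properties as Fin
open import Data.Fin.Permutation using (permutation)
open import Data.Integer using (+_)
open import Data.List using (List; []; _∷_; length; filter; foldr; allFin)
open import Data.List.Properties using (length-removeAt′; length-tabulate)
open import Data.List.Relation.Unary.All as All using ([]; _∷_)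
open import Data.List.Relation.Unary.All.Properties using (¬Any⇒All¬)
open import Data.List.Relation.Unary.Any using (here; there; _─_; any?)
open import Data.List.Relation.Unary.Unique.Propositional using (Unique; []; _∷_)
open import Data.List.Relation.Unary.Unique.Propositional.Properties using (filter⁺; allFin⁺)
open import Data.List.Membership.Propositional using (_∈_; _∉_)
open import Data.List.Membership.Propositional.Properties using (∈-filter⁺; ∈-filter⁻; ∈-allFin)
open import Data.List.Relation.Binary.Subset.Propositional using (_⊆_)
open import Data.Product using (Σ; ∃; ∃₂; _×_; _,_; proj₁; proj₂)
open import Data.Sum using (_⊎_; inj₁; inj₂)
open import Data.Bool using (if_then_else_)
open import Data.Empty using (⊥; ⊥-elim)
open import Relation.Nullary using (¬_; Dec; yes; no; does; ¬?)
open import Relation.Nullary.Decidable using (_×-dec_; _→-dec_; decidable-stable)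
open import Relation.Binary.Definitions using (Decidable)
open import Relation.Binary.PropositionalEquality as ≡ using (_≡_; _≢_; ≢-sym)
open import Algebra.Bundles using (CommutativeRing)
open import Algebra.Properties.CommutativeMonoid.Sum ℕ.+-0-commutativeMonoid using (sum; ∑-permute; ∑-distrib-+; sum-cong-≗)

module _ {a} {A : Set a} where

  ∈-─⁺ : ∀ {x y : A} {ys} (x∈ys : x ∈ ys) → y ∈ ys → y ≢ x → y ∈ (ys ─ x∈ys)
  ∈-─⁺ (here ≡.refl) (here ≡.refl) y≢x = ⊥-elim (y≢x ≡.refl)
  ∈-─⁺ (here ≡.refl) (there y∈ys)  _   = y∈ys
  ∈-─⁺ (there x∈ys)  (here ≡.refl) _   = here ≡.refl
  ∈-─⁺ (there x∈ys)  (there y∈ys)  y≢x = there (∈-─⁺ x∈ys y∈ys y≢x)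

  Unique-⊆⇒length≤ : ∀ {xs ys : List A} → Unique xs → xs ⊆ ys → length xs ≤ length ys
  Unique-⊆⇒length≤ {[]}     _                    _     = z≤n
  Unique-⊆⇒length≤ {x ∷ xs} {ys} (x∉xs ∷ unique) xs⊆ys = ℕ.≤-trans
    (s≤s (Unique-⊆⇒length≤ unique (λ y∈xs → ∈-─⁺ x∈ys (xs⊆ys (there y∈xs)) (λ y≡x → All.lookup x∉xs y∈xs (≡.sym y≡x)))))
    (ℕ.≤-reflexive (≡.sym (length-removeAt′ ys _)))
    where
    x∈ys : x ∈ ys
    x∈ys = xs⊆ys (here ≡.refl)

Unique-exhaustive : ∀ {n} {xs : List (Fin n)} → Unique xs → length xs ≡ n → ∀ x → x ∈ xs
Unique-exhaustive {n} {xs} unique |xs|≡n x with any? (x Fin.≟_) xs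
... | yes x∈xs = x∈xs
... | no  x∉xs = ⊥-elim (ℕ.n≮n n (≡.subst (_≤ n) (≡.cong suc |xs|≡n) |x∷xs|≤n))
  where
  |x∷xs|≤n : suc (length xs) ≤ n
  |x∷xs|≤n = ≡.subst (suc (length xs) ≤_) (length-tabulate (λ i → i))
               (Unique-⊆⇒length≤ (¬Any⇒All¬ xs x∉xs ∷ unique) (λ {y} _ → ∈-allFin y))

∃∉ : ∀ {n} (xs : List (Fin n)) → length xs < n → ∃ λ x → x ∉ xs
∃∉ {n} xs |xs|<n with Fin.any? (λ x → ¬? (any? (x Fin.≟_) xs))
... | yes x∉xs = x∉xs
... | no  none = ⊥-elim (ℕ.<⇒≱ |xs|<n (≡.subst (_≤ length xs) (length-tabulate (λ i → i))
                   (Unique-⊆⇒length≤ (allFin⁺ n) (λ {x} _ → decidable-stable (any? (x Fin.≟_) xs) (λ x∉xs → none (x , x∉xs))))))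

module _ {m : ℕ} {a b : Fin (suc (suc m))} (a≢b : a ≢ b) where

  punchOut₂ : ∀ {j} → a ≢ j → b ≢ j → Fin m
  punchOut₂ a≢j b≢j = punchOut {i = punchOut a≢b} {j = punchOut a≢j} (λ eq → b≢j (Fin.punchOut-injective a≢b a≢j eq))

  punchOut₂-injective : ∀ {j k} (a≢j : a ≢ j) (b≢j : b ≢ j) (a≢k : a ≢ k) (b≢k : b ≢ k) →
                        punchOut₂ a≢j b≢j ≡ punchOut₂ a≢k b≢k → j ≡ k
  punchOut₂-injective a≢j b≢j a≢k b≢k eq =
    Fin.punchOut-injective a≢j a≢k (Fin.punchOut-injective {i = punchOut a≢b} _ _ eq)

pigeonhole₂ : ∀ {m n} {a b : Fin (suc (suc m))} → m < n → a ≢ b → (f : Fin n → Fin (suc (suc m))) →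
              (∀ i → a ≢ f i) → (∀ i → b ≢ f i) → ∃₂ λ i j → i ≢ j × f i ≡ f j
pigeonhole₂ m<n a≢b f a≢f b≢f with Fin.pigeonhole m<n (λ i → punchOut₂ a≢b (a≢f i) (b≢f i))
... | i , j , i<j , same = i , j , Fin.<⇒≢ i<j , punchOut₂-injective a≢b (a≢f i) (b≢f i) (a≢f j) (b≢f j) same

module _ {n : ℕ} where

  [_<_] : Fin n → Fin n → ℕ
  [ i < j ] with i <? j
  ... | yes _ = 1
  ... | no  _ = 0

  [<]+[>]≡1 : ∀ {i j} → i ≢ j → [ i < j ] ℕ.+ [ j < i ] ≡ 1
  [<]+[>]≡1 {i} {j} i≢j with i <? j | j <? i
  ... | yes i<j | yes j<i = ⊥-elim (ℕ.<-asym i<j j<i)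
  ... | yes _   | no  _   = ≡.refl
  ... | no  _   | yes _   = ≡.refl
  ... | no  i≮j | no  j≮i = ⊥-elim (i≢j (Fin.toℕ-injective (ℕ.≤-antisym (ℕ.≮⇒≥ j≮i) (ℕ.≮⇒≥ i≮j))))

sum-ones : ∀ {n} (t : Fin n → ℕ) → (∀ i → t i ≡ 1) → sum t ≡ n
sum-ones {zero}  t t≡1 = ≡.refl
sum-ones {suc n} t t≡1 = ≡.cong₂ ℕ._+_ (t≡1 zero) (sum-ones (λ i → t (suc i)) (λ i → t≡1 (suc i)))

-- Summing [ i < σ i ] + [ σ i < i ] ≡ 1 over all i gives n, and reindexing along σ swaps the two halves.
fixedPointFreeInvolution⇒even : ∀ {n} (σ : Fin n → Fin n) → (∀ i → σ (σ i) ≡ i) → (∀ i → σ i ≢ i) →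
                                ∃ λ k → n ≡ k ℕ.+ k
fixedPointFreeInvolution⇒even {n} σ σ-involutive σ-fixedPointFree = ascents , (begin
  n                                     ≡⟨ sum-ones _ (λ i → [<]+[>]≡1 (λ i≡σi → σ-fixedPointFree i (≡.sym i≡σi))) ⟨
  sum (λ i → [ i < σ i ] ℕ.+ [ σ i < i ]) ≡⟨ ∑-distrib-+ (λ i → [ i < σ i ]) (λ i → [ σ i < i ]) ⟩
  ascents ℕ.+ sum (λ i → [ σ i < i ])   ≡⟨ ≡.cong (ascents ℕ.+_) ascents≡descents ⟨
  ascents ℕ.+ ascents                   ∎)
  where
  open ≡.≡-Reasoning
  ascents : ℕ
  ascents = sum (λ i → [ i < σ i ])
  ascents≡descents : ascents ≡ sum (λ i → [ σ i < i ])
  ascents≡descents = ≡.trans (∑-permute _ (permutation σ σ σ-involutive σ-involutive))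
                           (sum-cong-≗ (λ i → ≡.cong ([ σ i <_]) (σ-involutive i)))

-- The ring solver needs coefficients whose equality it can decide; the integers, mapped into R,
-- serve for every commutative ring.
module IntegerCoefficients {c ℓ : Level} (R : CommutativeRing c ℓ) where
  open CommutativeRing R
  open import Algebra.Properties.Semiring.Mult semiring using (×1-homo-*; ×-homo-+) renaming (_×_ to _×ₙ_)
  open import Algebra.Properties.AbelianGroup +-abelianGroup using (ε⁻¹≈ε; ⁻¹-involutive; ⁻¹-∙-comm)
  open import Algebra.Properties.Ring ring using (-‿distribˡ-*; -‿distribʳ-*; -‿involutive)
  open import Algebra.Solver.Ring.AlmostCommutativeRing using (fromCommutativeRing; _-Raw-AlmostCommutative⟶_)
  open import Algebra.Bundles using (Ring)
  open import Data.Integer as ℤ using (ℤ; -[1+_]; _⊖_)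
  import Data.Integer.Properties as ℤ
  open import Data.Sign as Sign using (Sign)
  open import Data.Maybe using (Maybe; just; nothing)
  open import Relation.Binary.Reasoning.Setoid setoid

  fromℕ : ℕ → Carrier
  fromℕ n = n ×ₙ 1#

  fromℤ : ℤ → Carrier
  fromℤ (+ n)      = fromℕ n
  fromℤ -[1+ n ]   = - fromℕ (suc n)

  signed : Sign → Carrier → Carrier
  signed Sign.+ x = x
  signed Sign.- x = - x

  signed-cong : ∀ s {x y} → x ≈ y → signed s x ≈ signed s y
  signed-cong Sign.+ x≈y = x≈y
  signed-cong Sign.- x≈y = -‿cong x≈y

  signed-* : ∀ s t x y → signed (s Sign.* t) (x * y) ≈ signed s x * signed t y
  signed-* Sign.+ Sign.+ x y = refl
  signed-* Sign.+ Sign.- x y = -‿distribʳ-* x y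
  signed-* Sign.- Sign.+ x y = -‿distribˡ-* x y
  signed-* Sign.- Sign.- x y = begin
    x * y         ≈⟨ -‿involutive (x * y) ⟨
    - - (x * y)   ≈⟨ -‿cong (-‿distribˡ-* x y) ⟩
    - (- x * y)   ≈⟨ -‿distribʳ-* (- x) y ⟩
    - x * - y     ∎

  fromℤ-◃ : ∀ s n → fromℤ (s ℤ.◃ n) ≈ signed s (fromℕ n)
  fromℤ-◃ Sign.+ zero    = refl
  fromℤ-◃ Sign.- zero    = sym ε⁻¹≈ε
  fromℤ-◃ Sign.+ (suc n) = refl
  fromℤ-◃ Sign.- (suc n) = refl

  fromℤ-signAbs : ∀ i → fromℤ i ≈ signed (ℤ.sign i) (fromℕ ℤ.∣ i ∣)
  fromℤ-signAbs (+ n)    = refl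
  fromℤ-signAbs -[1+ n ] = refl

  fromℤ-* : ∀ i j → fromℤ (i ℤ.* j) ≈ fromℤ i * fromℤ j
  fromℤ-* i j = begin
    fromℤ ((s Sign.* t) ℤ.◃ (m ℕ.* n))     ≈⟨ fromℤ-◃ (s Sign.* t) (m ℕ.* n) ⟩
    signed (s Sign.* t) (fromℕ (m ℕ.* n))   ≈⟨ signed-cong (s Sign.* t) (×1-homo-* m n) ⟩
    signed (s Sign.* t) (fromℕ m * fromℕ n) ≈⟨ signed-* s t _ _ ⟩
    signed s (fromℕ m) * signed t (fromℕ n) ≈⟨ *-cong (fromℤ-signAbs i) (fromℤ-signAbs j) ⟨
    fromℤ i * fromℤ j                       ∎
    where
    s t : Sign
    s = ℤ.sign i
    t = ℤ.sign j
    m n : ℕ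
    m = ℤ.∣ i ∣
    n = ℤ.∣ j ∣

  fromℤ-neg : ∀ i → fromℤ (ℤ.- i) ≈ - fromℤ i
  fromℤ-neg (+ zero)  = sym ε⁻¹≈ε
  fromℤ-neg (+ suc n) = refl
  fromℤ-neg -[1+ n ]  = sym (⁻¹-involutive _)

  fromℤ-⊖ : ∀ m n → fromℤ (m ⊖ n) ≈ fromℕ m - fromℕ n
  fromℤ-⊖ zero    zero    = sym (-‿inverseʳ 0#)
  fromℤ-⊖ (suc m) zero    = begin
    fromℕ (suc m)          ≈⟨ +-identityʳ _ ⟨
    fromℕ (suc m) + 0#     ≈⟨ +-congˡ ε⁻¹≈ε ⟨
    fromℕ (suc m) - 0#     ∎
  fromℤ-⊖ zero    (suc n) = sym (+-identityˡ _)
  fromℤ-⊖ (suc m) (suc n) = begin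
    fromℤ (suc m ⊖ suc n)                                  ≡⟨ ≡.cong fromℤ (ℤ.[1+m]⊖[1+n]≡m⊖n m n) ⟩
    fromℤ (m ⊖ n)                                          ≈⟨ fromℤ-⊖ m n ⟩
    fromℕ m - fromℕ n                                      ≈⟨ +-identityˡ _ ⟨
    0# + (fromℕ m - fromℕ n)                               ≈⟨ +-congʳ (-‿inverseʳ 1#) ⟨
    (1# - 1#) + (fromℕ m - fromℕ n)                        ≈⟨ +-assoc 1# (- 1#) _ ⟩
    1# + (- 1# + (fromℕ m - fromℕ n))                      ≈⟨ +-congˡ (+-assoc (- 1#) (fromℕ m) _) ⟨
    1# + ((- 1# + fromℕ m) - fromℕ n)                      ≈⟨ +-congˡ (+-congʳ (+-comm (- 1#) (fromℕ m))) ⟩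
    1# + ((fromℕ m - 1#) - fromℕ n)                        ≈⟨ +-congˡ (+-assoc (fromℕ m) (- 1#) _) ⟩
    1# + (fromℕ m + (- 1# - fromℕ n))                      ≈⟨ +-assoc 1# (fromℕ m) _ ⟨
    fromℕ (suc m) + (- 1# - fromℕ n)                       ≈⟨ +-congˡ (⁻¹-∙-comm 1# (fromℕ n)) ⟩
    fromℕ (suc m) - fromℕ (suc n)                          ∎

  fromℤ-+ : ∀ i j → fromℤ (i ℤ.+ j) ≈ fromℤ i + fromℤ j
  fromℤ-+ -[1+ m ] -[1+ n ] = begin
    - fromℕ (suc (suc (m ℕ.+ n)))          ≡⟨ ≡.cong (λ k → - fromℕ (suc k)) (ℕ.+-suc m n) ⟨
    - fromℕ (suc m ℕ.+ suc n)              ≈⟨ -‿cong (×-homo-+ 1# (suc m) (suc n)) ⟩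
    - (fromℕ (suc m) + fromℕ (suc n))      ≈⟨ ⁻¹-∙-comm _ _ ⟨
    - fromℕ (suc m) - fromℕ (suc n)        ∎
  fromℤ-+ -[1+ m ] (+ n)    = trans (fromℤ-⊖ n (suc m)) (+-comm _ _)
  fromℤ-+ (+ m)    -[1+ n ] = fromℤ-⊖ m (suc n)
  fromℤ-+ (+ m)    (+ n)    = ×-homo-+ 1# m n

  fromℤ-homomorphism : Ring.rawRing ℤ.+-*-ring -Raw-AlmostCommutative⟶ fromCommutativeRing R
  fromℤ-homomorphism = record
    { ⟦_⟧ = fromℤ ; +-homo = fromℤ-+ ; *-homo = fromℤ-* ; -‿homo = fromℤ-neg
    ; 0-homo = refl ; 1-homo = +-identityʳ 1# }

  coefficient≟ : ∀ i j → Maybe (fromℤ i ≈ fromℤ j)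
  coefficient≟ i j with i ℤ.≟ j
  ... | yes ≡.refl = just refl
  ... | no _       = nothing

  open import Algebra.Solver.Ring _ (fromCommutativeRing R) fromℤ-homomorphism coefficient≟ public

-- Stated over an arbitrary signature so that the same definitions give both vectors over a ring and
-- their symbolic counterparts for the solver. The trailing 0a makes dot u w definitionally
-- sumFin (λ i → u i * w i), hence encode G u j is definitionally dot u (column j of G).
module VectorOperations {a} {A : Set a} (_+_ _*_ : A → A → A) (-_ : A → A) (0a : A) where

  ⟨_,_,_⟩ : A → A → A → Fin 3 → A
  ⟨ x , y , z ⟩ zero             = x
  ⟨ x , y , z ⟩ (suc zero)       = y
  ⟨ x , y , z ⟩ (suc (suc zero)) = z

  dot : (Fin 3 → A) → (Fin 3 → A) → A
  dot u w = (u zero * w zero) + ((u (suc zero) * w (suc zero)) + ((u (suc (suc zero)) * w (suc (suc zero))) + 0a))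

  cross : (Fin 3 → A) → (Fin 3 → A) → Fin 3 → A
  cross u w zero             = (u (suc zero) * w (suc (suc zero))) + (- (u (suc (suc zero)) * w (suc zero)))
  cross u w (suc zero)       = (u (suc (suc zero)) * w zero) + (- (u zero * w (suc (suc zero))))
  cross u w (suc (suc zero)) = (u zero * w (suc zero)) + (- (u (suc zero) * w zero))

  det : (Fin 3 → A) → (Fin 3 → A) → (Fin 3 → A) → A
  det u v w = dot (cross u v) w

module Coordinates {c ℓ : Level} (F : CommutativeRing c ℓ) where
  open CommutativeRing F hiding (zero)
  open IntegerCoefficients F using (solve; Polynomial; _:+_; _:*_; :-_; _:-_; _:=_; con)

  Vec3 : Set c
  Vec3 = Fin 3 → Carrier

  open VectorOperations _+_ _*_ -_ 0# public

  module Symbolic {n} = VectorOperations {A = Polynomial n} _:+_ _:*_ :-_ (con (+ 0))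
  open Symbolic public using () renaming (⟨_,_,_⟩ to ⟪_,_,_⟫; dot to dotₚ; cross to crossₚ; det to detₚ)

  0F 1F 2F : Fin 3
  0F = zero
  1F = suc zero
  2F = suc (suc zero)

  det-cyclic : ∀ u v w → det u v w ≈ det v w u
  det-cyclic u v w = solve 9 (λ u₀ u₁ u₂ v₀ v₁ v₂ w₀ w₁ w₂ →
      detₚ ⟪ u₀ , u₁ , u₂ ⟫ ⟪ v₀ , v₁ , v₂ ⟫ ⟪ w₀ , w₁ , w₂ ⟫ := detₚ ⟪ v₀ , v₁ , v₂ ⟫ ⟪ w₀ , w₁ , w₂ ⟫ ⟪ u₀ , u₁ , u₂ ⟫)
    refl (u 0F) (u 1F) (u 2F) (v 0F) (v 1F) (v 2F) (w 0F) (w 1F) (w 2F)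

  dot-comm : ∀ u w → dot u w ≈ dot w u
  dot-comm u w = solve 6 (λ u₀ u₁ u₂ w₀ w₁ w₂ →
      dotₚ ⟪ u₀ , u₁ , u₂ ⟫ ⟪ w₀ , w₁ , w₂ ⟫ := dotₚ ⟪ w₀ , w₁ , w₂ ⟫ ⟪ u₀ , u₁ , u₂ ⟫)
    refl (u 0F) (u 1F) (u 2F) (w 0F) (w 1F) (w 2F)

  det-swap : ∀ u v w → det u v w + det u w v ≈ 0#
  det-swap u v w = solve 9 (λ u₀ u₁ u₂ v₀ v₁ v₂ w₀ w₁ w₂ →
      detₚ ⟪ u₀ , u₁ , u₂ ⟫ ⟪ v₀ , v₁ , v₂ ⟫ ⟪ w₀ , w₁ , w₂ ⟫ :+ detₚ ⟪ u₀ , u₁ , u₂ ⟫ ⟪ w₀ , w₁ , w₂ ⟫ ⟪ v₀ , v₁ , v₂ ⟫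
        := con (+ 0))
    refl (u 0F) (u 1F) (u 2F) (v 0F) (v 1F) (v 2F) (w 0F) (w 1F) (w 2F)

  det-repeatˡ : ∀ u v → det u v u ≈ 0#
  det-repeatˡ u v = solve 6 (λ u₀ u₁ u₂ v₀ v₁ v₂ →
      detₚ ⟪ u₀ , u₁ , u₂ ⟫ ⟪ v₀ , v₁ , v₂ ⟫ ⟪ u₀ , u₁ , u₂ ⟫ := con (+ 0))
    refl (u 0F) (u 1F) (u 2F) (v 0F) (v 1F) (v 2F)

  det-repeatʳ : ∀ u v → det u v v ≈ 0#
  det-repeatʳ u v = solve 6 (λ u₀ u₁ u₂ v₀ v₁ v₂ →
      detₚ ⟪ u₀ , u₁ , u₂ ⟫ ⟪ v₀ , v₁ , v₂ ⟫ ⟪ v₀ , v₁ , v₂ ⟫ := con (+ 0))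
    refl (u 0F) (u 1F) (u 2F) (v 0F) (v 1F) (v 2F)

  dot-linearˡ : ∀ s x y w → dot (λ i → s * x i + y i) w ≈ s * dot x w + dot y w
  dot-linearˡ s x y w = solve 10 (λ s x₀ x₁ x₂ y₀ y₁ y₂ w₀ w₁ w₂ →
      dotₚ ⟪ s :* x₀ :+ y₀ , s :* x₁ :+ y₁ , s :* x₂ :+ y₂ ⟫ ⟪ w₀ , w₁ , w₂ ⟫
        := s :* dotₚ ⟪ x₀ , x₁ , x₂ ⟫ ⟪ w₀ , w₁ , w₂ ⟫ :+ dotₚ ⟪ y₀ , y₁ , y₂ ⟫ ⟪ w₀ , w₁ , w₂ ⟫)
    refl s (x 0F) (x 1F) (x 2F) (y 0F) (y 1F) (y 2F) (w 0F) (w 1F) (w 2F)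

  cross-antisym : ∀ u w i → cross w u i ≈ - cross u w i
  cross-antisym u w zero = solve 6 (λ u₀ u₁ u₂ w₀ w₁ w₂ →
      crossₚ ⟪ w₀ , w₁ , w₂ ⟫ ⟪ u₀ , u₁ , u₂ ⟫ 0F := :- crossₚ ⟪ u₀ , u₁ , u₂ ⟫ ⟪ w₀ , w₁ , w₂ ⟫ 0F)
    refl (u 0F) (u 1F) (u 2F) (w 0F) (w 1F) (w 2F)
  cross-antisym u w (suc zero) = solve 6 (λ u₀ u₁ u₂ w₀ w₁ w₂ →
      crossₚ ⟪ w₀ , w₁ , w₂ ⟫ ⟪ u₀ , u₁ , u₂ ⟫ 1F := :- crossₚ ⟪ u₀ , u₁ , u₂ ⟫ ⟪ w₀ , w₁ , w₂ ⟫ 1F)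
    refl (u 0F) (u 1F) (u 2F) (w 0F) (w 1F) (w 2F)
  cross-antisym u w (suc (suc zero)) = solve 6 (λ u₀ u₁ u₂ w₀ w₁ w₂ →
      crossₚ ⟪ w₀ , w₁ , w₂ ⟫ ⟪ u₀ , u₁ , u₂ ⟫ 2F := :- crossₚ ⟪ u₀ , u₁ , u₂ ⟫ ⟪ w₀ , w₁ , w₂ ⟫ 2F)
    refl (u 0F) (u 1F) (u 2F) (w 0F) (w 1F) (w 2F)

  cross-self : ∀ u i → cross u u i ≈ 0#
  cross-self u zero = solve 2 (λ x y → x :* y :- y :* x := con (+ 0)) refl (u 1F) (u 2F)
  cross-self u (suc zero) = solve 2 (λ x y → x :* y :- y :* x := con (+ 0)) refl (u 2F) (u 0F)
  cross-self u (suc (suc zero)) = solve 2 (λ x y → x :* y :- y :* x := con (+ 0)) refl (u 0F) (u 1F)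

  cross-cross : ∀ u v w i → cross u (cross v w) i ≈ dot u w * v i - dot u v * w i
  cross-cross u v w zero = solve 9 (λ u₀ u₁ u₂ v₀ v₁ v₂ w₀ w₁ w₂ →
      crossₚ ⟪ u₀ , u₁ , u₂ ⟫ (crossₚ ⟪ v₀ , v₁ , v₂ ⟫ ⟪ w₀ , w₁ , w₂ ⟫) 0F
        := dotₚ ⟪ u₀ , u₁ , u₂ ⟫ ⟪ w₀ , w₁ , w₂ ⟫ :* v₀ :- dotₚ ⟪ u₀ , u₁ , u₂ ⟫ ⟪ v₀ , v₁ , v₂ ⟫ :* w₀)
    refl (u 0F) (u 1F) (u 2F) (v 0F) (v 1F) (v 2F) (w 0F) (w 1F) (w 2F)
  cross-cross u v w (suc zero) = solve 9 (λ u₀ u₁ u₂ v₀ v₁ v₂ w₀ w₁ w₂ →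
      crossₚ ⟪ u₀ , u₁ , u₂ ⟫ (crossₚ ⟪ v₀ , v₁ , v₂ ⟫ ⟪ w₀ , w₁ , w₂ ⟫) 1F
        := dotₚ ⟪ u₀ , u₁ , u₂ ⟫ ⟪ w₀ , w₁ , w₂ ⟫ :* v₁ :- dotₚ ⟪ u₀ , u₁ , u₂ ⟫ ⟪ v₀ , v₁ , v₂ ⟫ :* w₁)
    refl (u 0F) (u 1F) (u 2F) (v 0F) (v 1F) (v 2F) (w 0F) (w 1F) (w 2F)
  cross-cross u v w (suc (suc zero)) = solve 9 (λ u₀ u₁ u₂ v₀ v₁ v₂ w₀ w₁ w₂ →
      crossₚ ⟪ u₀ , u₁ , u₂ ⟫ (crossₚ ⟪ v₀ , v₁ , v₂ ⟫ ⟪ w₀ , w₁ , w₂ ⟫) 2F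
        := dotₚ ⟪ u₀ , u₁ , u₂ ⟫ ⟪ w₀ , w₁ , w₂ ⟫ :* v₂ :- dotₚ ⟪ u₀ , u₁ , u₂ ⟫ ⟪ v₀ , v₁ , v₂ ⟫ :* w₂)
    refl (u 0F) (u 1F) (u 2F) (v 0F) (v 1F) (v 2F) (w 0F) (w 1F) (w 2F)

  dot-cong : ∀ {u u′ w w′} → (∀ i → u i ≈ u′ i) → (∀ i → w i ≈ w′ i) → dot u w ≈ dot u′ w′
  dot-cong u≈ w≈ = +-cong (*-cong (u≈ 0F) (w≈ 0F)) (+-cong (*-cong (u≈ 1F) (w≈ 1F)) (+-cong (*-cong (u≈ 2F) (w≈ 2F)) refl))

  cross-cong : ∀ {u u′ w w′} → (∀ i → u i ≈ u′ i) → (∀ i → w i ≈ w′ i) → ∀ i → cross u w i ≈ cross u′ w′ i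
  cross-cong u≈ w≈ zero             = +-cong (*-cong (u≈ 1F) (w≈ 2F)) (-‿cong (*-cong (u≈ 2F) (w≈ 1F)))
  cross-cong u≈ w≈ (suc zero)       = +-cong (*-cong (u≈ 2F) (w≈ 0F)) (-‿cong (*-cong (u≈ 0F) (w≈ 2F)))
  cross-cong u≈ w≈ (suc (suc zero)) = +-cong (*-cong (u≈ 0F) (w≈ 1F)) (-‿cong (*-cong (u≈ 1F) (w≈ 0F)))

  det-cong : ∀ {u u′ v v′ w w′} → (∀ i → u i ≈ u′ i) → (∀ i → v i ≈ v′ i) → (∀ i → w i ≈ w′ i) →
             det u v w ≈ det u′ v′ w′
  det-cong u≈ v≈ w≈ = dot-cong (cross-cong u≈ v≈) w≈

  det-combination : ∀ α β γ δ ε ζ e f b →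
    det (λ i → α * e i - β * f i) (λ i → γ * b i - δ * f i) (λ i → ε * b i - ζ * e i) ≈ det e f b * (β * γ * ζ - α * δ * ε)
  det-combination α β γ δ ε ζ e f b = solve 15 (λ α β γ δ ε ζ e₀ e₁ e₂ f₀ f₁ f₂ b₀ b₁ b₂ →
      detₚ ⟪ α :* e₀ :- β :* f₀ , α :* e₁ :- β :* f₁ , α :* e₂ :- β :* f₂ ⟫
           ⟪ γ :* b₀ :- δ :* f₀ , γ :* b₁ :- δ :* f₁ , γ :* b₂ :- δ :* f₂ ⟫
           ⟪ ε :* b₀ :- ζ :* e₀ , ε :* b₁ :- ζ :* e₁ , ε :* b₂ :- ζ :* e₂ ⟫
        := detₚ ⟪ e₀ , e₁ , e₂ ⟫ ⟪ f₀ , f₁ , f₂ ⟫ ⟪ b₀ , b₁ , b₂ ⟫ :* (β :* γ :* ζ :- α :* δ :* ε))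
    refl α β γ δ ε ζ (e 0F) (e 1F) (e 2F) (f 0F) (f 1F) (f 2F) (b 0F) (b 1F) (b 2F)

HasInverses : ∀ {c ℓ} → CommutativeRing c ℓ → Set (c ⊔ ℓ)
HasInverses F = ∀ x → ¬ x ≈ 0# → Σ Carrier λ y → x * y ≈ 1#
  where open CommutativeRing F

module Geometry {c ℓ : Level} (F : CommutativeRing c ℓ) (_≟_ : Decidable (CommutativeRing._≈_ F))
                (inverse : HasInverses F) where
  open CommutativeRing F hiding (zero)
  open IntegerCoefficients F using (solve; _:+_; _:*_; :-_; _:-_; _:=_; con)
  open Coordinates F
  open import Relation.Binary.Reasoning.Setoid setoid

  +≈0 : ∀ {x y} → x ≈ 0# → y ≈ 0# → x + y ≈ 0#
  +≈0 x≈0 y≈0 = trans (+-cong x≈0 y≈0) (+-identityˡ 0#)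

  *≈0ˡ : ∀ {x} y → x ≈ 0# → x * y ≈ 0#
  *≈0ˡ y x≈0 = trans (*-congʳ x≈0) (zeroˡ y)

  *≈0ʳ : ∀ x {y} → y ≈ 0# → x * y ≈ 0#
  *≈0ʳ x y≈0 = trans (*-congˡ y≈0) (zeroʳ x)

  -≈0 : ∀ {x} → x ≈ 0# → - x ≈ 0#
  -≈0 x≈0 = trans (-‿cong x≈0) (solve 0 (:- con (+ 0) := con (+ 0)) refl)

  -≈0⁻¹ : ∀ {x} → - x ≈ 0# → x ≈ 0#
  -≈0⁻¹ {x} -x≈0 = trans (solve 1 (λ x → x := :- (:- x)) refl x) (-≈0 -x≈0)

  subtrahend≈0 : ∀ {x y} → x - y ≈ 0# → x ≈ 0# → y ≈ 0#
  subtrahend≈0 {x} {y} x-y≈0 x≈0 = begin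
    y             ≈⟨ solve 2 (λ x y → y := x :- (x :- y)) refl x y ⟩
    x - (x - y)   ≈⟨ +≈0 x≈0 (-≈0 x-y≈0) ⟩
    0#            ∎

  s*0-x≈-x : ∀ s x → s * 0# + - x ≈ - x
  s*0-x≈-x = solve 2 (λ s x → s :* con (+ 0) :+ :- x := :- x) refl

  *-cancel-≉0 : ∀ {x y} → ¬ x ≈ 0# → x * y ≈ 0# → y ≈ 0#
  *-cancel-≉0 {x} {y} x≉0 xy≈0 with x⁻¹ , x*x⁻¹≈1 ← inverse x x≉0 = begin
    y               ≈⟨ *-identityˡ y ⟨
    1# * y          ≈⟨ *-congʳ x*x⁻¹≈1 ⟨
    (x * x⁻¹) * y   ≈⟨ *-congʳ (*-comm x x⁻¹) ⟩
    (x⁻¹ * x) * y   ≈⟨ *-assoc x⁻¹ x y ⟩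
    x⁻¹ * (x * y)   ≈⟨ *≈0ʳ x⁻¹ xy≈0 ⟩
    0#              ∎

  *-≉0 : ∀ {x y} → ¬ x ≈ 0# → ¬ y ≈ 0# → ¬ x * y ≈ 0#
  *-≉0 x≉0 y≉0 xy≈0 = y≉0 (*-cancel-≉0 x≉0 xy≈0)

  IsZero : Vec3 → Set ℓ
  IsZero = IsZeroVec F _≟_

  IsZero? : ∀ v → Dec (IsZero v)
  IsZero? v = Fin.all? (λ i → v i ≟ 0#)

  nonzeroCoordinate : ∀ {v} → ¬ IsZero v → ∃ λ k → ¬ v k ≈ 0#
  nonzeroCoordinate {v} v≉0 = Fin.¬∀⟶∃¬ 3 _ (λ i → v i ≟ 0#) v≉0

  cross-zeroˡ : ∀ {u} w → IsZero u → IsZero (cross u w)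
  cross-zeroˡ w u≈0 zero             = +≈0 (*≈0ˡ _ (u≈0 1F)) (-≈0 (*≈0ˡ _ (u≈0 2F)))
  cross-zeroˡ w u≈0 (suc zero)       = +≈0 (*≈0ˡ _ (u≈0 2F)) (-≈0 (*≈0ˡ _ (u≈0 0F)))
  cross-zeroˡ w u≈0 (suc (suc zero)) = +≈0 (*≈0ˡ _ (u≈0 0F)) (-≈0 (*≈0ˡ _ (u≈0 1F)))

  cross-zeroʳ : ∀ u {w} → IsZero w → IsZero (cross u w)
  cross-zeroʳ u {w} w≈0 i = trans (cross-antisym w u i) (-≈0 (cross-zeroˡ u w≈0 i))

  infix 4 _∥_
  _∥_ : Vec3 → Vec3 → Set ℓ
  u ∥ w = IsZero (cross u w)

  ∥-refl : ∀ u → u ∥ u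
  ∥-refl = cross-self

  ∥-sym : ∀ {u w} → u ∥ w → w ∥ u
  ∥-sym {u} {w} u∥w i = trans (cross-antisym u w i) (-≈0 (u∥w i))

  -- (u · p) x − (u · x) p = u × (x × p) vanishes, and p has a nonzero coordinate to cancel.
  ∥-orthogonal : ∀ {p x} u → ¬ IsZero p → x ∥ p → dot u p ≈ 0# → dot u x ≈ 0#
  ∥-orthogonal {p} {x} u p≉0 x∥p u⊥p with k , pₖ≉0 ← nonzeroCoordinate p≉0 = *-cancel-≉0 pₖ≉0 (begin
    p k * dot u x   ≈⟨ *-comm (p k) (dot u x) ⟩
    dot u x * p k   ≈⟨ subtrahend≈0 (trans (sym (cross-cross u x p k)) (cross-zeroʳ u x∥p k)) (*≈0ˡ (x k) u⊥p) ⟩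
    0#              ∎)

  ⊥⊥⇒∥-cross : ∀ n₁ n₂ {x} → dot n₁ x ≈ 0# → dot n₂ x ≈ 0# → x ∥ cross n₁ n₂
  ⊥⊥⇒∥-cross n₁ n₂ {x} n₁⊥x n₂⊥x i = begin
    cross x (cross n₁ n₂) i                  ≈⟨ cross-cross x n₁ n₂ i ⟩
    dot x n₂ * n₁ i - dot x n₁ * n₂ i        ≈⟨ +≈0 (*≈0ˡ _ (trans (dot-comm x n₂) n₂⊥x)) (-≈0 (*≈0ˡ _ (trans (dot-comm x n₁) n₁⊥x))) ⟩
    0#                                       ∎

  det-transfer : ∀ {x y} v w → ¬ IsZero x → x ∥ y → det x v w ≈ 0# → det y v w ≈ 0#
  det-transfer {x} {y} v w x≉0 x∥y xvw≈0 = begin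
    det y v w   ≈⟨ det-cyclic y v w ⟩
    det v w y   ≈⟨ ∥-orthogonal (cross v w) x≉0 (∥-sym x∥y) (trans (sym (det-cyclic x v w)) xvw≈0) ⟩
    0#          ∎

  -- The normals e₁ and s e₁ + e₂ (s ∈ F) of the q + 1 lines through the point p.
  record PencilBasis (p : Vec3) : Set (c ⊔ ℓ) where
    field
      e₁ e₂     : Vec3
      e₁⊥p      : dot e₁ p ≈ 0#
      e₂⊥p      : dot e₂ p ≈ 0#
      ⊥e₁e₂⇒∥p  : ∀ x → dot e₁ x ≈ 0# → dot e₂ x ≈ 0# → x ∥ p
      e₁≉0      : ¬ IsZero e₁
      se₁+e₂≉0  : ∀ s → ¬ IsZero (λ i → s * e₁ i + e₂ i)

  pencilBasis₀ : ∀ p → ¬ p 0F ≈ 0# → PencilBasis p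
  pencilBasis₀ p p₀≉0 = record
    { e₁ = ⟨ p₁ , - p₀ , 0# ⟩ ; e₂ = ⟨ p₂ , 0# , - p₀ ⟩
    ; e₁⊥p = solve 3 (λ p₀ p₁ p₂ → dotₚ ⟪ p₁ , :- p₀ , con (+ 0) ⟫ ⟪ p₀ , p₁ , p₂ ⟫ := con (+ 0)) refl p₀ p₁ p₂
    ; e₂⊥p = solve 3 (λ p₀ p₁ p₂ → dotₚ ⟪ p₂ , con (+ 0) , :- p₀ ⟫ ⟪ p₀ , p₁ , p₂ ⟫ := con (+ 0)) refl p₀ p₁ p₂
    ; ⊥e₁e₂⇒∥p = λ x e₁⊥x e₂⊥x → λ
        { zero → *-cancel-≉0 p₀≉0 (trans (solve 6 (λ p₀ p₁ p₂ x₀ x₁ x₂ →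
              p₀ :* crossₚ ⟪ x₀ , x₁ , x₂ ⟫ ⟪ p₀ , p₁ , p₂ ⟫ 0F
                := p₁ :* dotₚ ⟪ p₂ , con (+ 0) , :- p₀ ⟫ ⟪ x₀ , x₁ , x₂ ⟫ :- p₂ :* dotₚ ⟪ p₁ , :- p₀ , con (+ 0) ⟫ ⟪ x₀ , x₁ , x₂ ⟫)
              refl p₀ p₁ p₂ (x 0F) (x 1F) (x 2F)) (+≈0 (*≈0ʳ p₁ e₂⊥x) (-≈0 (*≈0ʳ p₂ e₁⊥x))))
        ; (suc zero) → trans (solve 6 (λ p₀ p₁ p₂ x₀ x₁ x₂ →
              crossₚ ⟪ x₀ , x₁ , x₂ ⟫ ⟪ p₀ , p₁ , p₂ ⟫ 1F := :- dotₚ ⟪ p₂ , con (+ 0) , :- p₀ ⟫ ⟪ x₀ , x₁ , x₂ ⟫)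
              refl p₀ p₁ p₂ (x 0F) (x 1F) (x 2F)) (-≈0 e₂⊥x)
        ; (suc (suc zero)) → trans (solve 6 (λ p₀ p₁ p₂ x₀ x₁ x₂ →
              crossₚ ⟪ x₀ , x₁ , x₂ ⟫ ⟪ p₀ , p₁ , p₂ ⟫ 2F := dotₚ ⟪ p₁ , :- p₀ , con (+ 0) ⟫ ⟪ x₀ , x₁ , x₂ ⟫)
              refl p₀ p₁ p₂ (x 0F) (x 1F) (x 2F)) e₁⊥x }
    ; e₁≉0 = λ e₁≈0 → p₀≉0 (-≈0⁻¹ (e₁≈0 1F))
    ; se₁+e₂≉0 = λ s v≈0 → p₀≉0 (-≈0⁻¹ (trans (sym (s*0-x≈-x s p₀)) (v≈0 2F)))
    }
    where
    p₀ p₁ p₂ : Carrier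
    p₀ = p 0F
    p₁ = p 1F
    p₂ = p 2F

  pencilBasis₁ : ∀ p → ¬ p 1F ≈ 0# → PencilBasis p
  pencilBasis₁ p p₁≉0 = record
    { e₁ = ⟨ - p₁ , p₀ , 0# ⟩ ; e₂ = ⟨ 0# , p₂ , - p₁ ⟩
    ; e₁⊥p = solve 3 (λ p₀ p₁ p₂ → dotₚ ⟪ :- p₁ , p₀ , con (+ 0) ⟫ ⟪ p₀ , p₁ , p₂ ⟫ := con (+ 0)) refl p₀ p₁ p₂
    ; e₂⊥p = solve 3 (λ p₀ p₁ p₂ → dotₚ ⟪ con (+ 0) , p₂ , :- p₁ ⟫ ⟪ p₀ , p₁ , p₂ ⟫ := con (+ 0)) refl p₀ p₁ p₂
    ; ⊥e₁e₂⇒∥p = λ x e₁⊥x e₂⊥x → λ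
        { zero → trans (solve 6 (λ p₀ p₁ p₂ x₀ x₁ x₂ →
              crossₚ ⟪ x₀ , x₁ , x₂ ⟫ ⟪ p₀ , p₁ , p₂ ⟫ 0F := dotₚ ⟪ con (+ 0) , p₂ , :- p₁ ⟫ ⟪ x₀ , x₁ , x₂ ⟫)
              refl p₀ p₁ p₂ (x 0F) (x 1F) (x 2F)) e₂⊥x
        ; (suc zero) → *-cancel-≉0 p₁≉0 (trans (solve 6 (λ p₀ p₁ p₂ x₀ x₁ x₂ →
              p₁ :* crossₚ ⟪ x₀ , x₁ , x₂ ⟫ ⟪ p₀ , p₁ , p₂ ⟫ 1F
                := p₂ :* dotₚ ⟪ :- p₁ , p₀ , con (+ 0) ⟫ ⟪ x₀ , x₁ , x₂ ⟫ :- p₀ :* dotₚ ⟪ con (+ 0) , p₂ , :- p₁ ⟫ ⟪ x₀ , x₁ , x₂ ⟫)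
              refl p₀ p₁ p₂ (x 0F) (x 1F) (x 2F)) (+≈0 (*≈0ʳ p₂ e₁⊥x) (-≈0 (*≈0ʳ p₀ e₂⊥x))))
        ; (suc (suc zero)) → trans (solve 6 (λ p₀ p₁ p₂ x₀ x₁ x₂ →
              crossₚ ⟪ x₀ , x₁ , x₂ ⟫ ⟪ p₀ , p₁ , p₂ ⟫ 2F := :- dotₚ ⟪ :- p₁ , p₀ , con (+ 0) ⟫ ⟪ x₀ , x₁ , x₂ ⟫)
              refl p₀ p₁ p₂ (x 0F) (x 1F) (x 2F)) (-≈0 e₁⊥x) }
    ; e₁≉0 = λ e₁≈0 → p₁≉0 (-≈0⁻¹ (e₁≈0 0F))
    ; se₁+e₂≉0 = λ s v≈0 → p₁≉0 (-≈0⁻¹ (trans (sym (s*0-x≈-x s p₁)) (v≈0 2F)))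
    }
    where
    p₀ p₁ p₂ : Carrier
    p₀ = p 0F
    p₁ = p 1F
    p₂ = p 2F

  pencilBasis₂ : ∀ p → ¬ p 2F ≈ 0# → PencilBasis p
  pencilBasis₂ p p₂≉0 = record
    { e₁ = ⟨ - p₂ , 0# , p₀ ⟩ ; e₂ = ⟨ 0# , - p₂ , p₁ ⟩
    ; e₁⊥p = solve 3 (λ p₀ p₁ p₂ → dotₚ ⟪ :- p₂ , con (+ 0) , p₀ ⟫ ⟪ p₀ , p₁ , p₂ ⟫ := con (+ 0)) refl p₀ p₁ p₂
    ; e₂⊥p = solve 3 (λ p₀ p₁ p₂ → dotₚ ⟪ con (+ 0) , :- p₂ , p₁ ⟫ ⟪ p₀ , p₁ , p₂ ⟫ := con (+ 0)) refl p₀ p₁ p₂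
    ; ⊥e₁e₂⇒∥p = λ x e₁⊥x e₂⊥x → λ
        { zero → trans (solve 6 (λ p₀ p₁ p₂ x₀ x₁ x₂ →
              crossₚ ⟪ x₀ , x₁ , x₂ ⟫ ⟪ p₀ , p₁ , p₂ ⟫ 0F := :- dotₚ ⟪ con (+ 0) , :- p₂ , p₁ ⟫ ⟪ x₀ , x₁ , x₂ ⟫)
              refl p₀ p₁ p₂ (x 0F) (x 1F) (x 2F)) (-≈0 e₂⊥x)
        ; (suc zero) → trans (solve 6 (λ p₀ p₁ p₂ x₀ x₁ x₂ →
              crossₚ ⟪ x₀ , x₁ , x₂ ⟫ ⟪ p₀ , p₁ , p₂ ⟫ 1F := dotₚ ⟪ :- p₂ , con (+ 0) , p₀ ⟫ ⟪ x₀ , x₁ , x₂ ⟫)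
              refl p₀ p₁ p₂ (x 0F) (x 1F) (x 2F)) e₁⊥x
        ; (suc (suc zero)) → *-cancel-≉0 p₂≉0 (trans (solve 6 (λ p₀ p₁ p₂ x₀ x₁ x₂ →
              p₂ :* crossₚ ⟪ x₀ , x₁ , x₂ ⟫ ⟪ p₀ , p₁ , p₂ ⟫ 2F
                := p₀ :* dotₚ ⟪ con (+ 0) , :- p₂ , p₁ ⟫ ⟪ x₀ , x₁ , x₂ ⟫ :- p₁ :* dotₚ ⟪ :- p₂ , con (+ 0) , p₀ ⟫ ⟪ x₀ , x₁ , x₂ ⟫)
              refl p₀ p₁ p₂ (x 0F) (x 1F) (x 2F)) (+≈0 (*≈0ʳ p₀ e₂⊥x) (-≈0 (*≈0ʳ p₁ e₁⊥x)))) }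
    ; e₁≉0 = λ e₁≈0 → p₂≉0 (-≈0⁻¹ (e₁≈0 0F))
    ; se₁+e₂≉0 = λ s v≈0 → p₂≉0 (-≈0⁻¹ (trans (sym (s*0-x≈-x s p₂)) (v≈0 1F)))
    }
    where
    p₀ p₁ p₂ : Carrier
    p₀ = p 0F
    p₁ = p 1F
    p₂ = p 2F

  pencilBasis : ∀ p → ¬ IsZero p → PencilBasis p
  pencilBasis p p≉0 with nonzeroCoordinate p≉0
  ... | zero             , p₀≉0 = pencilBasis₀ p p₀≉0
  ... | suc zero         , p₁≉0 = pencilBasis₁ p p₁≉0
  ... | suc (suc zero)   , p₂≉0 = pencilBasis₂ p p₂≉0

  commonLine : ∀ {p} → ¬ IsZero p → ∀ x → ∃ λ u → ¬ IsZero u × dot u p ≈ 0# × dot u x ≈ 0#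
  commonLine {p} p≉0 x with IsZero? (cross x p)
  ... | yes x∥p = e₁ , e₁≉0 , e₁⊥p , ∥-orthogonal e₁ p≉0 x∥p e₁⊥p
    where open PencilBasis (pencilBasis p p≉0)
  ... | no  x∦p = cross p x , (λ p∥x → x∦p (∥-sym p∥x)) , det-repeatˡ p x , det-repeatʳ p x

  module Pencil {q : ℕ} (enum : Fin q → Carrier) (enum-injective : ∀ i j → enum i ≈ enum j → i ≡ j)
                {p : Vec3} (p≉0 : ¬ IsZero p) where
    open PencilBasis (pencilBasis p p≉0)

    normal : Fin (suc q) → Vec3
    normal zero    = e₁
    normal (suc s) = λ i → enum s * e₁ i + e₂ i

    normal⊥p : ∀ i → dot (normal i) p ≈ 0#
    normal⊥p zero    = e₁⊥p
    normal⊥p (suc s) = trans (dot-linearˡ _ e₁ e₂ p) (+≈0 (*≈0ʳ _ e₁⊥p) e₂⊥p)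

    normal≉0 : ∀ i → ¬ IsZero (normal i)
    normal≉0 zero    = e₁≉0
    normal≉0 (suc s) = se₁+e₂≉0 (enum s)

    private
      e₂⊥ : ∀ {s x} → dot e₁ x ≈ 0# → dot (normal (suc s)) x ≈ 0# → dot e₂ x ≈ 0#
      e₂⊥ {s} {x} e₁⊥x ⊥x = begin
        dot e₂ x                      ≈⟨ +-identityˡ _ ⟨
        0# + dot e₂ x                 ≈⟨ +-congʳ (*≈0ʳ (enum s) e₁⊥x) ⟨
        enum s * dot e₁ x + dot e₂ x  ≈⟨ dot-linearˡ (enum s) e₁ e₂ x ⟨
        dot (normal (suc s)) x        ≈⟨ ⊥x ⟩
        0#                            ∎

    normal-unique : ∀ {i j x} → ¬ x ∥ p → dot (normal i) x ≈ 0# → dot (normal j) x ≈ 0# → i ≡ j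
    normal-unique {zero}  {zero}  x∦p _ _ = ≡.refl
    normal-unique {zero}  {suc t} {x} x∦p e₁⊥x ⊥x = ⊥-elim (x∦p (⊥e₁e₂⇒∥p x e₁⊥x (e₂⊥ {x = x} e₁⊥x ⊥x)))
    normal-unique {suc s} {zero}  {x} x∦p ⊥x e₁⊥x = ⊥-elim (x∦p (⊥e₁e₂⇒∥p x e₁⊥x (e₂⊥ {x = x} e₁⊥x ⊥x)))
    normal-unique {suc s} {suc t} {x} x∦p ⊥ₛx ⊥ₜx with dot e₁ x ≟ 0#
    ... | yes e₁⊥x = ⊥-elim (x∦p (⊥e₁e₂⇒∥p x e₁⊥x (e₂⊥ {x = x} e₁⊥x ⊥ₛx)))
    ... | no e₁x≉0 = ≡.cong suc (enum-injective s t (begin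
      enum s                              ≈⟨ solve 2 (λ s t → s := (s :- t) :+ t) refl (enum s) (enum t) ⟩
      (enum s - enum t) + enum t          ≈⟨ +-congʳ (*-cancel-≉0 e₁x≉0 s-t≈0) ⟩
      0# + enum t                         ≈⟨ +-identityˡ _ ⟩
      enum t                              ∎))
      where
      difference : ∀ s t y z → y * (s - t) ≈ (s * y + z) - (t * y + z)
      difference = solve 4 (λ s t y z → y :* (s :- t) := (s :* y :+ z) :- (t :* y :+ z)) refl
      s-t≈0 : dot e₁ x * (enum s - enum t) ≈ 0#
      s-t≈0 = begin
        dot e₁ x * (enum s - enum t)                                          ≈⟨ difference (enum s) (enum t) (dot e₁ x) (dot e₂ x) ⟩
        (enum s * dot e₁ x + dot e₂ x) - (enum t * dot e₁ x + dot e₂ x)       ≈⟨ +-cong (dot-linearˡ (enum s) e₁ e₂ x) (-‿cong (dot-linearˡ (enum t) e₁ e₂ x)) ⟨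
        dot (normal (suc s)) x - dot (normal (suc t)) x                       ≈⟨ +≈0 ⊥ₛx (-≈0 ⊥ₜx) ⟩
        0#                                                                    ∎

    Avoids : ∀ {n} → (Fin n → Vec3) → Vec3 → Set ℓ
    Avoids g u = ∀ j → ¬ g j ∥ p → ¬ dot u (g j) ≈ 0#

    avoids? : ∀ {n} (g : Fin n → Vec3) u → Dec (Avoids g u)
    avoids? g u = Fin.all? (λ j → ¬? (IsZero? (cross (g j) p)) →-dec ¬? (dot u (g j) ≟ 0#))

    meets : ∀ {n} (g : Fin n → Vec3) {u} → ¬ Avoids g u → ∃ λ j → ¬ g j ∥ p × dot u (g j) ≈ 0#
    meets g {u} ¬avoids with Fin.¬∀⟶∃¬ _ _ (λ j → ¬? (IsZero? (cross (g j) p)) →-dec ¬? (dot u (g j) ≟ 0#)) ¬avoids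
    ... | j , ¬avoidsⱼ with IsZero? (cross (g j) p) | dot u (g j) ≟ 0#
    ...   | yes j∥p | _      = ⊥-elim (¬avoidsⱼ (λ j∦p → ⊥-elim (j∦p j∥p)))
    ...   | no j∦p  | yes on = j , j∦p , on
    ...   | no _    | no off = ⊥-elim (¬avoidsⱼ (λ _ → off))

    -- At most m points off p meet at most m of the q + 1 lines through p.
    lineAvoiding : ∀ {m} (g : Fin (suc (suc m)) → Vec3) {a b} → a ≢ b → g a ∥ p → g b ∥ p → m < suc q →
                   ∃ λ u → dot u p ≈ 0# × ¬ IsZero u × Avoids g u
    lineAvoiding {m} g {a} {b} a≢b a∥p b∥p m<q+1 = pick (Fin.any? (λ i → avoids? g (normal i)))
      where
      allMeet⇒⊥ : (∀ i → ∃ λ j → ¬ g j ∥ p × dot (normal i) (g j) ≈ 0#) → ⊥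
      allMeet⇒⊥ meet with pigeonhole₂ m<q+1 a≢b (λ i → proj₁ (meet i))
                             (λ i a≡ → proj₁ (proj₂ (meet i)) (≡.subst (λ j → g j ∥ p) a≡ a∥p))
                             (λ i b≡ → proj₁ (proj₂ (meet i)) (≡.subst (λ j → g j ∥ p) b≡ b∥p))
      ... | i , i′ , i≢i′ , same = i≢i′ (normal-unique (proj₁ (proj₂ (meet i))) (proj₂ (proj₂ (meet i)))
                                      (≡.subst (λ j → dot (normal i′) (g j) ≈ 0#) (≡.sym same) (proj₂ (proj₂ (meet i′)))))

      pick : Dec (∃ λ i → Avoids g (normal i)) → ∃ λ u → dot u p ≈ 0# × ¬ IsZero u × Avoids g u
      pick (yes (i , avoids)) = normal i , normal⊥p i , normal≉0 i , avoids
      pick (no none) = ⊥-elim (allMeet⇒⊥ (λ i → meets g {normal i} (λ avoids → none (i , avoids))))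

  -- c, d, g are proportional to these intersections of opposite sides, so they pass det c d g ≈ 0 on.
  intersectionsOfOppositeSides-collinear : ∀ a b e f {c d g} →
    det a b c ≈ 0# → det e f c ≈ 0# → det a e d ≈ 0# → det b f d ≈ 0# → det a f g ≈ 0# → det b e g ≈ 0# →
    ¬ IsZero c → ¬ IsZero d → ¬ IsZero g → det c d g ≈ 0# →
    det (cross (cross a b) (cross e f)) (cross (cross a e) (cross b f)) (cross (cross a f) (cross b e)) ≈ 0#
  intersectionsOfOppositeSides-collinear a b e f {c} {d} {g} abc efc aed bfd afg beg c≉0 d≉0 g≉0 cdg =
    trans (det-cyclic n₁ n₂ n₃) (trans (det-cyclic n₂ n₃ n₁) n₃n₁n₂)
    where
    n₁ n₂ n₃ : Vec3
    n₁ = cross (cross a b) (cross e f)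
    n₂ = cross (cross a e) (cross b f)
    n₃ = cross (cross a f) (cross b e)
    n₁dg : det n₁ d g ≈ 0#
    n₁dg = det-transfer d g c≉0 (⊥⊥⇒∥-cross (cross a b) (cross e f) abc efc) cdg
    n₂gn₁ : det n₂ g n₁ ≈ 0#
    n₂gn₁ = det-transfer g n₁ d≉0 (⊥⊥⇒∥-cross (cross a e) (cross b f) aed bfd) (trans (sym (det-cyclic n₁ d g)) n₁dg)
    n₃n₁n₂ : det n₃ n₁ n₂ ≈ 0#
    n₃n₁n₂ = det-transfer n₁ n₂ g≉0 (⊥⊥⇒∥-cross (cross a f) (cross b e) afg beg) (trans (sym (det-cyclic n₂ g n₁)) n₂gn₁)

  -- c = ab ∩ ef, d = ae ∩ bf and g = af ∩ be are the diagonal points of the quadrangle a, b, e, f.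
  diagonalPointsCollinear⇒2≈0 : ∀ a b e f {c d g} →
    ¬ det a b f ≈ 0# → ¬ det a b e ≈ 0# → ¬ det a e f ≈ 0# → ¬ det e f b ≈ 0# →
    det a b c ≈ 0# → det e f c ≈ 0# → det a e d ≈ 0# → det b f d ≈ 0# → det a f g ≈ 0# → det b e g ≈ 0# →
    ¬ IsZero c → ¬ IsZero d → ¬ IsZero g → det c d g ≈ 0# → 1# + 1# ≈ 0#
  diagonalPointsCollinear⇒2≈0 a b e f α≉0 β≉0 γ≉0 efb≉0 abc efc aed bfd afg beg c≉0 d≉0 g≉0 cdg =
    *-cancel-≉0 (*-≉0 (*-≉0 α≉0 β≉0) γ≉0) (begin
      x * (1# + 1#)        ≈⟨ trans (distribˡ x 1# 1#) (+-cong (*-identityʳ x) (*-identityʳ x)) ⟩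
      x + x                ≈⟨ twice ⟩
      (ζ + α) * (β * γ) + ((δ + β) * - (α * ε) + ((ε + γ) * (α * β) - S))
        ≈⟨ +≈0 (*≈0ˡ _ (det-swap a f b)) (+≈0 (*≈0ˡ _ (det-swap a e b)) (+≈0 (*≈0ˡ _ (det-swap a f e)) (-≈0 S≈0))) ⟩
      0#                   ∎)
    where
    α β γ δ ε ζ S x : Carrier
    α = det a b f
    β = det a b e
    γ = det a e f
    δ = det a e b
    ε = det a f e
    ζ = det a f b
    S = β * γ * ζ - α * δ * ε
    x = α * β * γ

    S≈0 : S ≈ 0#
    S≈0 = *-cancel-≉0 efb≉0 (begin
      det e f b * S
        ≈⟨ det-combination α β γ δ ε ζ e f b ⟨
      det (λ i → α * e i - β * f i) (λ i → γ * b i - δ * f i) (λ i → ε * b i - ζ * e i)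
        ≈⟨ det-cong (cross-cross (cross a b) e f) (cross-cross (cross a e) b f) (cross-cross (cross a f) b e) ⟨
      det (cross (cross a b) (cross e f)) (cross (cross a e) (cross b f)) (cross (cross a f) (cross b e))
        ≈⟨ intersectionsOfOppositeSides-collinear a b e f abc efc aed bfd afg beg c≉0 d≉0 g≉0 cdg ⟩
      0#  ∎)

    twice : x + x ≈ (ζ + α) * (β * γ) + ((δ + β) * - (α * ε) + ((ε + γ) * (α * β) - S))
    twice = solve 6 (λ α β γ δ ε ζ →
      α :* β :* γ :+ α :* β :* γ := (ζ :+ α) :* (β :* γ) :+ ((δ :+ β) :* (:- (α :* ε)) :+
        ((ε :+ γ) :* (α :* β) :- (β :* γ :* ζ :- α :* δ :* ε)))) refl α β γ δ ε ζ

module SevenPointPlane {ℓ} (Collinear : Fin 7 → Fin 7 → Fin 7 → Set ℓ)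
  (swap₁₂ : ∀ {a b c} → Collinear a b c → Collinear b a c)
  (swap₂₃ : ∀ {a b c} → Collinear a b c → Collinear a c b)
  (third : ∀ {a b} → b ≢ a → ∃ λ c → c ≢ a × c ≢ b × Collinear a b c)
  (noFourth : ∀ {a b c d} → Collinear a b c → Collinear a b d →
              b ≢ a → c ≢ a → d ≢ a → c ≢ b → d ≢ b → d ≢ c → ⊥) where

  rotate : ∀ {a b c} → Collinear a b c → Collinear b c a
  rotate t = swap₂₃ (swap₁₂ t)

  rotate⁻¹ : ∀ {a b c} → Collinear a b c → Collinear c a b
  rotate⁻¹ t = swap₁₂ (swap₂₃ t)

  record FanoConfiguration : Set ℓ where
    field
      a b e f c d g : Fin 7
      abc : Collinear a b c
      efc : Collinear e f c
      aed : Collinear a e d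
      bfd : Collinear b f d
      afg : Collinear a f g
      beg : Collinear b e g
      cdg : Collinear c d g
      ¬abf : ¬ Collinear a b f
      ¬abe : ¬ Collinear a b e
      ¬aef : ¬ Collinear a e f
      ¬efb : ¬ Collinear e f b

  module Construction
    {A B C D E F G : Fin 7} (B≢A : B ≢ A)
    (C≢A : C ≢ A) (C≢B : C ≢ B) (ABC : Collinear A B C)
    (D≢A : D ≢ A) (D≢B : D ≢ B) (D≢C : D ≢ C)
    (E≢A : E ≢ A) (E≢D : E ≢ D) (ADE : Collinear A D E)
    (F≢B : F ≢ B) (F≢D : F ≢ D) (BDF : Collinear B D F)
    (G≢C : G ≢ C) (G≢D : G ≢ D) (CDG : Collinear C D G) where

    ¬ABD : ¬ Collinear A B D
    ¬ABD t = noFourth ABC t B≢A C≢A D≢A C≢B D≢B D≢C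
    ¬ACD : ¬ Collinear A C D
    ¬ACD t = noFourth (swap₂₃ ABC) t C≢A B≢A D≢A (≢-sym C≢B) D≢C D≢B
    ¬BCD : ¬ Collinear B C D
    ¬BCD t = noFourth (rotate ABC) t C≢B (≢-sym B≢A) D≢B (≢-sym C≢A) D≢C D≢A

    E≢B : E ≢ B
    E≢B ≡.refl = ¬ABD (swap₂₃ ADE)
    E≢C : E ≢ C
    E≢C ≡.refl = ¬ACD (swap₂₃ ADE)
    F≢A : F ≢ A
    F≢A ≡.refl = ¬ABD (rotate⁻¹ BDF)
    F≢C : F ≢ C
    F≢C ≡.refl = ¬BCD (swap₂₃ BDF)
    F≢E : F ≢ E
    F≢E ≡.refl = noFourth (rotate ADE) (rotate BDF) E≢D (≢-sym D≢A) (≢-sym D≢B) (≢-sym E≢A) (≢-sym E≢B) B≢A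
    G≢A : G ≢ A
    G≢A ≡.refl = ¬ACD (rotate⁻¹ CDG)
    G≢B : G ≢ B
    G≢B ≡.refl = ¬BCD (rotate⁻¹ CDG)
    G≢E : G ≢ E
    G≢E ≡.refl = noFourth (rotate CDG) (rotate ADE) G≢D (≢-sym D≢C) (≢-sym D≢A) (≢-sym G≢C) (≢-sym E≢A) (≢-sym C≢A)
    G≢F : G ≢ F
    G≢F ≡.refl = noFourth (rotate CDG) (rotate BDF) G≢D (≢-sym D≢C) (≢-sym D≢B) (≢-sym G≢C) (≢-sym F≢B) (≢-sym C≢B)

    ¬ABE : ¬ Collinear A B E
    ¬ABE t = noFourth ABC t B≢A C≢A E≢A C≢B E≢B E≢C
    ¬ABF : ¬ Collinear A B F
    ¬ABF t = noFourth ABC t B≢A C≢A F≢A C≢B F≢B F≢C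
    ¬AEF : ¬ Collinear A E F
    ¬AEF t = noFourth (swap₂₃ ADE) t E≢A D≢A F≢A (≢-sym E≢D) F≢E F≢D
    ¬BFE : ¬ Collinear B F E
    ¬BFE t = noFourth (swap₂₃ BDF) t F≢B D≢B E≢B (≢-sym F≢D) (≢-sym F≢E) E≢D

    points : List (Fin 7)
    points = G ∷ F ∷ E ∷ D ∷ C ∷ B ∷ A ∷ []

    exhaustive : ∀ x → x ∈ points
    exhaustive = Unique-exhaustive
      ( (G≢F ∷ G≢E ∷ G≢D ∷ G≢C ∷ G≢B ∷ G≢A ∷ [])
      ∷ (F≢E ∷ F≢D ∷ F≢C ∷ F≢B ∷ F≢A ∷ [])
      ∷ (E≢D ∷ E≢C ∷ E≢B ∷ E≢A ∷ [])
      ∷ (D≢C ∷ D≢B ∷ D≢A ∷ [])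
      ∷ (C≢B ∷ C≢A ∷ [])
      ∷ (B≢A ∷ [])
      ∷ [] ∷ [])
      ≡.refl

    thirdIs : ∀ {x y w} → y ≢ x → (∀ {z} → z ∈ points → z ≢ x → z ≢ y → Collinear x y z → Collinear x y w) →
              Collinear x y w
    thirdIs y≢x identify with third y≢x
    ... | z , z≢x , z≢y , t = identify (exhaustive z) z≢x z≢y t

    AFG : Collinear A F G
    AFG = thirdIs F≢A λ where
      (here ≡.refl)                                          _ _ t → t
      (there (here ≡.refl))                                  _ z≢F _ → ⊥-elim (z≢F ≡.refl)
      (there (there (here ≡.refl)))                          _ _ t → ⊥-elim (¬AEF (swap₂₃ t))
      (there (there (there (here ≡.refl))))                  _ _ t → ⊥-elim (noFourth ADE (swap₂₃ t) D≢A E≢A F≢A E≢D F≢D F≢E)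
      (there (there (there (there (here ≡.refl)))))          _ _ t → ⊥-elim (noFourth (swap₂₃ ABC) (swap₂₃ t) C≢A B≢A F≢A (≢-sym C≢B) F≢C F≢B)
      (there (there (there (there (there (here ≡.refl))))))  _ _ t → ⊥-elim (¬ABF (swap₂₃ t))
      (there (there (there (there (there (there (here ≡.refl))))))) z≢A _ _ → ⊥-elim (z≢A ≡.refl)

    BEG : Collinear B E G
    BEG = thirdIs E≢B λ where
      (here ≡.refl)                                          _ _ t → t
      (there (here ≡.refl))                                  _ _ t → ⊥-elim (¬BFE (swap₂₃ t))
      (there (there (here ≡.refl)))                          _ z≢E _ → ⊥-elim (z≢E ≡.refl)
      (there (there (there (here ≡.refl))))                  _ _ t → ⊥-elim (noFourth BDF (swap₂₃ t) D≢B F≢B E≢B F≢D E≢D (≢-sym F≢E))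
      (there (there (there (there (here ≡.refl)))))          _ _ t → ⊥-elim (noFourth (rotate ABC) (swap₂₃ t) C≢B (≢-sym B≢A) E≢B (≢-sym C≢A) E≢C E≢A)
      (there (there (there (there (there (here ≡.refl))))))  z≢B _ _ → ⊥-elim (z≢B ≡.refl)
      (there (there (there (there (there (there (here ≡.refl))))))) _ _ t → ⊥-elim (¬ABE (rotate⁻¹ t))

    EFC : Collinear E F C
    EFC = thirdIs F≢E λ where
      (here ≡.refl)                                          _ _ t → ⊥-elim (noFourth (rotate AFG) (rotate t) G≢F (≢-sym F≢A) (≢-sym F≢E) (≢-sym G≢A) (≢-sym G≢E) E≢A)
      (there (here ≡.refl))                                  _ z≢F _ → ⊥-elim (z≢F ≡.refl)
      (there (there (here ≡.refl)))                          z≢E _ _ → ⊥-elim (z≢E ≡.refl)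
      (there (there (there (here ≡.refl))))                  _ _ t → ⊥-elim (noFourth (rotate ADE) (rotate⁻¹ t) E≢D (≢-sym D≢A) F≢D (≢-sym E≢A) F≢E F≢A)
      (there (there (there (there (here ≡.refl)))))          _ _ t → t
      (there (there (there (there (there (here ≡.refl))))))  _ _ t → ⊥-elim (¬BFE (swap₂₃ (rotate⁻¹ t)))
      (there (there (there (there (there (there (here ≡.refl))))))) _ _ t → ⊥-elim (¬AEF (rotate⁻¹ t))

    configuration : FanoConfiguration
    configuration = record
      { a = A ; b = B ; e = E ; f = F ; c = C ; d = D ; g = G
      ; abc = ABC ; efc = EFC ; aed = swap₂₃ ADE ; bfd = swap₂₃ BDF ; afg = AFG ; beg = BEG ; cdg = CDG
      ; ¬abf = ¬ABF ; ¬abe = ¬ABE ; ¬aef = ¬AEF ; ¬efb = λ t → ¬BFE (swap₂₃ (rotate⁻¹ t)) }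

  fanoConfiguration : FanoConfiguration
  fanoConfiguration
    with C , C≢A , C≢B , ABC ← third {zero} {suc zero} (λ ())
    with D , D∉ABC ← ∃∉ (zero ∷ suc zero ∷ C ∷ []) (s≤s (s≤s (s≤s (s≤s z≤n))))
    with D≢A ∷ D≢B ∷ D≢C ∷ [] ← ¬Any⇒All¬ _ D∉ABC
    with E , E≢A , E≢D , ADE ← third D≢A
    with F , F≢B , F≢D , BDF ← third D≢B
    with G , G≢C , G≢D , CDG ← third D≢C
    = Construction.configuration (λ ()) C≢A C≢B ABC D≢A D≢B D≢C E≢A E≢D ADE F≢B F≢D BDF G≢C G≢D CDG

module HammingWeight {c ℓ : Level} (F : CommutativeRing c ℓ) (_≟_ : Decidable (CommutativeRing._≈_ F)) where
  open CommutativeRing F using (Carrier; 0#)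

  zeroCoordinates : ∀ {n} → (Fin n → Carrier) → List (Fin n)
  zeroCoordinates {n} v = filter (λ i → v i ≟ 0#) (allFin n)

  weight+#zeroCoordinates : ∀ {n} (v : Fin n → Carrier) → weight F _≟_ v ℕ.+ length (zeroCoordinates v) ≡ n
  weight+#zeroCoordinates {n} v = ≡.trans (count (allFin n)) (length-tabulate (λ i → i))
    where
    count : ∀ xs → foldr (λ i acc → (if does (v i ≟ 0#) then 0 else 1) ℕ.+ acc) 0 xs
                     ℕ.+ length (filter (λ i → v i ≟ 0#) xs) ≡ length xs
    count []       = ≡.refl
    count (x ∷ xs) with v x ≟ 0#
    ... | yes _ = ≡.trans (ℕ.+-suc _ _) (≡.cong suc (count xs))
    ... | no  _ = ≡.cong suc (count xs)

Weight467 : ℕ → Set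
Weight467 w = w ≡ 4 ⊎ w ≡ 6 ⊎ w ≡ 7

#zeros-bounds : ∀ {w z} → Weight467 w → w ℕ.+ z ≡ 7 → z ≤ 3 × z ≢ 2
#zeros-bounds (inj₁ ≡.refl)        ≡.refl = s≤s (s≤s (s≤s z≤n)) , λ ()
#zeros-bounds (inj₂ (inj₁ ≡.refl)) ≡.refl = s≤s z≤n , λ ()
#zeros-bounds (inj₂ (inj₂ ≡.refl)) ≡.refl = z≤n , λ ()

module Weight467Code {ℓ₁ ℓ₂ : Level} (F : CommutativeRing ℓ₁ ℓ₂) {q : ℕ} (FF : IsFiniteField F q) (4<q : 4 < q)
  (G : Fin 3 → Fin 7 → CommutativeRing.Carrier F)
  (weights : ∀ u → ¬ IsZeroVec F (IsFiniteField._≟_ FF) u →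
               Weight467 (weight F (IsFiniteField._≟_ FF) (encode F (IsFiniteField._≟_ FF) G u))) where
  open CommutativeRing F hiding (zero)
  open IsFiniteField FF
  open Coordinates F
  open Geometry F _≟_ inverse
  open HammingWeight F _≟_
  open import Relation.Binary.Reasoning.Setoid setoid

  -- The columns of G are points of the projective plane; a nonzero message u is a line, and
  -- the zero coordinates of uG are the points on that line.
  point : Fin 7 → Vec3
  point j i = G i j

  infix 4 _∋_
  _∋_ : Vec3 → Fin 7 → Set ℓ₂
  u ∋ j = dot u (point j) ≈ 0#

  pointsOn : Vec3 → List (Fin 7)
  pointsOn u = zeroCoordinates (encode F _≟_ G u)

  ∋⇒∈pointsOn : ∀ {u j} → u ∋ j → j ∈ pointsOn u
  ∋⇒∈pointsOn {u} {j} = ∈-filter⁺ (λ i → encode F _≟_ G u i ≟ 0#) (∈-allFin j)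

  ∈pointsOn⇒∋ : ∀ {u j} → j ∈ pointsOn u → u ∋ j
  ∈pointsOn⇒∋ {u} j∈ = proj₂ (∈-filter⁻ (λ i → encode F _≟_ G u i ≟ 0#) j∈)

  #pointsOn : ∀ {u} → ¬ IsZero u → length (pointsOn u) ≤ 3 × length (pointsOn u) ≢ 2
  #pointsOn {u} u≉0 = #zeros-bounds (weights u u≉0) (weight+#zeroCoordinates (encode F _≟_ G u))

  noFourOnALine : ∀ {u a b c d} → ¬ IsZero u → Unique (a ∷ b ∷ c ∷ d ∷ []) →
                  u ∋ a → u ∋ b → u ∋ c → u ∋ d → ⊥
  noFourOnALine {u} u≉0 distinct u∋a u∋b u∋c u∋d =
    ℕ.<⇒≱ (s≤s (proj₁ (#pointsOn u≉0))) (Unique-⊆⇒length≤ distinct λ where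
      (here ≡.refl)                         → ∋⇒∈pointsOn {u} u∋a
      (there (here ≡.refl))                 → ∋⇒∈pointsOn {u} u∋b
      (there (there (here ≡.refl)))         → ∋⇒∈pointsOn {u} u∋c
      (there (there (there (here ≡.refl)))) → ∋⇒∈pointsOn {u} u∋d)

  thirdOnALine : ∀ {u a b} → ¬ IsZero u → b ≢ a → u ∋ a → u ∋ b → ∃ λ c → c ≢ a × c ≢ b × u ∋ c
  thirdOnALine {u} {a} {b} u≉0 b≢a u∋a u∋b
    with Fin.any? (λ c → ¬? (c Fin.≟ a) ×-dec ¬? (c Fin.≟ b) ×-dec (dot u (point c) ≟ 0#))
  ... | yes third = third
  ... | no  none  = ⊥-elim (proj₂ (#pointsOn u≉0) (ℕ.≤-antisym
        (Unique-⊆⇒length≤ (filter⁺ (λ i → encode F _≟_ G u i ≟ 0#) (allFin⁺ 7)) onlyAB)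
        (Unique-⊆⇒length≤ ((≢-sym b≢a ∷ []) ∷ [] ∷ []) λ where
          (here ≡.refl)         → ∋⇒∈pointsOn {u} u∋a
          (there (here ≡.refl)) → ∋⇒∈pointsOn {u} u∋b)))
    where
    onlyAB : ∀ {j} → j ∈ pointsOn u → j ∈ a ∷ b ∷ []
    onlyAB {j} j∈ with j Fin.≟ a | j Fin.≟ b
    ... | yes j≡a | _       = here j≡a
    ... | no  _   | yes j≡b = there (here j≡b)
    ... | no  j≢a | no  j≢b = ⊥-elim (none (j , j≢a , j≢b , ∈pointsOn⇒∋ {u} j∈))

  -- A fourth point d lies on a common line with p, and that line then carries all four points.
  noThreeParallel : ∀ {p a b c} → ¬ IsZero p → Unique (a ∷ b ∷ c ∷ []) →
                    point a ∥ p → point b ∥ p → point c ∥ p → ⊥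
  noThreeParallel {p} {a} {b} {c} p≉0 distinct a∥p b∥p c∥p
    with d , d∉abc ← ∃∉ (a ∷ b ∷ c ∷ []) (s≤s (s≤s (s≤s (s≤s z≤n))))
    with u , u≉0 , u⊥p , u∋d ← commonLine p≉0 (point d)
    = noFourOnALine u≉0 (¬Any⇒All¬ _ d∉abc ∷ distinct) u∋d (on a∥p) (on b∥p) (on c∥p)
    where
    on : ∀ {j} → point j ∥ p → u ∋ j
    on j∥p = ∥-orthogonal u p≉0 j∥p u⊥p

  -- Some line u through p misses every point not parallel to p; its third point is then parallel to p.
  noParallelPair : ∀ {p a b} → ¬ IsZero p → b ≢ a → point a ∥ p → point b ∥ p → ⊥
  noParallelPair {p} {a} {b} p≉0 b≢a a∥p b∥p
    with u , u⊥p , u≉0 , avoids ← Pencil.lineAvoiding enum enum-inj p≉0 point (≢-sym b≢a) a∥p b∥p (s≤s 4<q)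
    with c , c≢a , c≢b , u∋c ← thirdOnALine u≉0 b≢a (∥-orthogonal u p≉0 a∥p u⊥p) (∥-orthogonal u p≉0 b∥p u⊥p)
    = noThreeParallel p≉0 ((≢-sym b≢a ∷ ≢-sym c≢a ∷ []) ∷ (≢-sym c≢b ∷ []) ∷ [] ∷ []) a∥p b∥p
        (decidable-stable (IsZero? (cross (point c) p)) (λ c∦p → avoids c c∦p u∋c))

  distinctPoints-∦ : ∀ {a b} → b ≢ a → ¬ point a ∥ point b
  distinctPoints-∦ {a} {b} b≢a a∥b with IsZero? (point a) | IsZero? (point b)
  ... | no  a≉0 | _       = noParallelPair a≉0 b≢a (∥-refl (point a)) (∥-sym a∥b)
  ... | yes _   | no  b≉0 = noParallelPair b≉0 b≢a a∥b (∥-refl (point b))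
  ... | yes a≈0 | yes b≈0 =
    noParallelPair {p = ⟨ 1# , 0# , 0# ⟩} (λ p≈0 → 1≉0 (p≈0 zero)) b≢a (cross-zeroˡ _ a≈0) (cross-zeroˡ _ b≈0)

  point≉0 : ∀ a → ¬ IsZero (point a)
  point≉0 a a≈0 with b , b∉[a] ← ∃∉ (a ∷ []) (s≤s (s≤s z≤n)) =
    distinctPoints-∦ (λ b≡a → b∉[a] (here b≡a)) (cross-zeroˡ (point b) a≈0)

  Collinear : Fin 7 → Fin 7 → Fin 7 → Set ℓ₂
  Collinear a b c = det (point a) (point b) (point c) ≈ 0#

  collinear-swap₂₃ : ∀ {a b c} → Collinear a b c → Collinear a c b
  collinear-swap₂₃ {a} {b} {c} abc = begin
    det (point a) (point c) (point b)                                       ≈⟨ +-identityˡ _ ⟨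
    0# + det (point a) (point c) (point b)                                  ≈⟨ +-congʳ abc ⟨
    det (point a) (point b) (point c) + det (point a) (point c) (point b)   ≈⟨ det-swap (point a) (point b) (point c) ⟩
    0#                                                                      ∎

  collinear-swap₁₂ : ∀ {a b c} → Collinear a b c → Collinear b a c
  collinear-swap₁₂ {a} {b} {c} abc = trans (det-cyclic (point b) (point a) (point c)) (collinear-swap₂₃ abc)

  collinear-third : ∀ {a b} → b ≢ a → ∃ λ c → c ≢ a × c ≢ b × Collinear a b c
  collinear-third {a} {b} b≢a =
    thirdOnALine (distinctPoints-∦ b≢a) b≢a (det-repeatˡ (point a) (point b)) (det-repeatʳ (point a) (point b))

  collinear-noFourth : ∀ {a b c d} → Collinear a b c → Collinear a b d →
                       b ≢ a → c ≢ a → d ≢ a → c ≢ b → d ≢ b → d ≢ c → ⊥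
  collinear-noFourth {a} {b} abc abd b≢a c≢a d≢a c≢b d≢b d≢c =
    noFourOnALine (distinctPoints-∦ b≢a)
      ((≢-sym b≢a ∷ ≢-sym c≢a ∷ ≢-sym d≢a ∷ []) ∷ (≢-sym c≢b ∷ ≢-sym d≢b ∷ []) ∷ (≢-sym d≢c ∷ []) ∷ [] ∷ [])
      (det-repeatˡ (point a) (point b)) (det-repeatʳ (point a) (point b)) abc abd

  2≈0 : 1# + 1# ≈ 0#
  2≈0 = diagonalPointsCollinear⇒2≈0 (point a) (point b) (point e) (point f)
          ¬abf ¬abe ¬aef ¬efb abc efc aed bfd afg beg (point≉0 c) (point≉0 d) (point≉0 g) cdg
    where
    open SevenPointPlane Collinear collinear-swap₁₂ collinear-swap₂₃ collinear-third collinear-noFourth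
    open FanoConfiguration fanoConfiguration

module _ {c ℓ : Level} (F : CommutativeRing c ℓ) {q : ℕ} (FF : IsFiniteField F q) where
  open CommutativeRing F hiding (zero)
  open IsFiniteField FF
  open IntegerCoefficients F using (solve; _:+_; :-_; _:=_)
  open import Relation.Binary.Reasoning.Setoid setoid

  -- In characteristic 2 the translation x ↦ x + 1 is a fixed-point-free involution of F.
  2≈0⇒even : 1# + 1# ≈ 0# → ∃ λ k → q ≡ k ℕ.+ k
  2≈0⇒even 2≈0 = fixedPointFreeInvolution⇒even σ σ-involutive σ-fixedPointFree
    where
    σ : Fin q → Fin q
    σ i = proj₁ (enum-sur (enum i + 1#))
    enum-σ : ∀ i → enum (σ i) ≈ enum i + 1#
    enum-σ i = proj₂ (enum-sur (enum i + 1#))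
    σ-involutive : ∀ i → σ (σ i) ≡ i
    σ-involutive i = enum-inj _ _ (begin
      enum (σ (σ i))       ≈⟨ enum-σ (σ i) ⟩
      enum (σ i) + 1#      ≈⟨ +-congʳ (enum-σ i) ⟩
      (enum i + 1#) + 1#   ≈⟨ +-assoc _ _ _ ⟩
      enum i + (1# + 1#)   ≈⟨ +-congˡ 2≈0 ⟩
      enum i + 0#          ≈⟨ +-identityʳ _ ⟩
      enum i               ∎)
    σ-fixedPointFree : ∀ i → σ i ≢ i
    σ-fixedPointFree i σi≡i = 1≉0 (begin
      1#                         ≈⟨ solve 2 (λ x o → o := :- x :+ (x :+ o)) refl (enum i) 1# ⟩
      - enum i + (enum i + 1#)   ≈⟨ +-congˡ (enum-σ i) ⟨
      - enum i + enum (σ i)      ≡⟨ ≡.cong (λ j → - enum i + enum j) σi≡i ⟩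
      - enum i + enum i          ≈⟨ -‿inverseˡ _ ⟩
      0#                         ∎)

odd⇒¬double : ∀ {n} → n % 2 ≡ 1 → ¬ ∃ λ k → n ≡ k ℕ.+ k
odd⇒¬double odd (k , ≡.refl) = ℕ.1+n≢0 (≡.trans (≡.sym odd) (≡.trans (≡.cong (_% 2) double) (m*n%n≡0 k 2)))
  where
  double : k ℕ.+ k ≡ k ℕ.* 2
  double = ≡.trans (≡.cong (k ℕ.+_) (≡.sym (ℕ.+-identityʳ k))) (ℕ.*-comm 2 k)

proposition1 : ∀ {c ℓ : Level} (q : ℕ) → IsPrimePower q → q % 2 ≡ 1 → q > 4 →
               (F : CommutativeRing c ℓ) → (FF : IsFiniteField F q) →
               ¬ (Σ (Fin 3 → Fin 7 → CommutativeRing.Carrier F) λ G →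
                   RowsIndependent F (IsFiniteField._≟_ FF) G ×
                   (∀ u → ¬ IsZeroVec F (IsFiniteField._≟_ FF) u →
                     (weight F (IsFiniteField._≟_ FF) (encode F (IsFiniteField._≟_ FF) G u) ≡ 4
                      ⊎ weight F (IsFiniteField._≟_ FF) (encode F (IsFiniteField._≟_ FF) G u) ≡ 6
                      ⊎ weight F (IsFiniteField._≟_ FF) (encode F (IsFiniteField._≟_ FF) G u) ≡ 7)))
proposition1 q _ q-odd 4<q F FF (G , _ , weights) =
  odd⇒¬double q-odd (2≈0⇒even F FF (Weight467Code.2≈0 F FF 4<q G weights))
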